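{- The set $\mathcal{B}$ of all blocking games has Property X: for all strictly $\mathscr{P}$-free $G,H\in\mathcal{B}$ with $o(G)=o(H)=\mathscr{N}$, (1) if $\mathrm{rtp}(G)=\mathrm{ltp}(H)=1$ and $G$ is a Left end while $H$ is not, then $o(G+H)=\mathscr{N}$; and (2) if $\mathrm{ltp}(G)=\mathrm{rtp}(H)=1$ and $H$ is a Right end while $G$ is not, then $o(G+H)=\mathscr{N}$.
   Context: Games are short misère-play game forms (no tombstones, so "end-like" coincides with "end"); outcomes $o(G)\in\{\mathscr{L},\mathscr{N},\mathscr{P},\mathscr{R}\}$. $+$ is disjunctive sum; $0=\{\cdot\mid\cdot\}$; for $n\ge1$ the integer $n$ is $\{n-1\mid\cdot\}$ and $\overline{n}$ is its conjugate. $\mathrm{ltp}(G)$ is the least integer $m\ge0$ with $o(G+\overline{m})=\mathscr{L}$; $\mathrm{rtp}(G)$ is the least $m\ge0$ with $o(G+m)=\mathscr{R}$. A subposition is any game reachable by a possibly empty, not necessarily alternating, sequence of moves; strictly $\mathscr{P}$-free: no subposition has outcome $\mathscr{P}$. A Left end is a game with no Left options (Right end symmetrically). A Left end $X$ is blocked if for every Right option $X^R$, either $X^R$ is a blocked Left end or some Left option $X^{RL}$ of $X^R$ is a blocked Left end; blocked Right ends symmetrically. A game is blocking if every subposition that is a Left (resp. Right) end is a blocked Left (resp. Right) end. -}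

module Defs where

open import Data.Nat using (ℕ; zero; suc; _<_)
open import Data.Bool using (Bool; true; false; _∧_; _∨_; not)
open import Data.List using (List; []; _∷_; _++_)
open import Data.List.Membership.Propositional using (_∈_)
open import Data.Product using (_×_)
open import Relation.Binary.PropositionalEquality using (_≡_; _≢_)
open import Relation.Nullary using (¬_)

data Game : Set where
  ⟨_∣_⟩ : List Game → List Game → Game

leftOpts : Game → List Game
leftOpts ⟨ L ∣ _ ⟩ = L

rightOpts : Game → List Game
rightOpts ⟨ _ ∣ R ⟩ = R

-- Misère play: a player who cannot move wins.
-- lf G : Left wins G moving first;  ls G : Left wins G moving second
-- (i.e. when Right moves first).
mutual
  lf : Game → Bool
  lf ⟨ [] ∣ _ ⟩ = true
  lf ⟨ x ∷ xs ∣ _ ⟩ = anyLs (x ∷ xs)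

  ls : Game → Bool
  ls ⟨ _ ∣ [] ⟩ = false
  ls ⟨ _ ∣ y ∷ ys ⟩ = allLf (y ∷ ys)

  anyLs : List Game → Bool
  anyLs [] = false
  anyLs (x ∷ xs) = ls x ∨ anyLs xs

  allLf : List Game → Bool
  allLf [] = true
  allLf (x ∷ xs) = lf x ∧ allLf xs

data Outcome : Set where
  𝓛 𝓝 𝓟 𝓡 : Outcome

-- Outcome classes (short games are determined: Right wins moving first
-- iff Left does not win moving second, etc.).
outcome : Bool → Bool → Outcome
outcome true  true  = 𝓛
outcome true  false = 𝓝
outcome false true  = 𝓟
outcome false false = 𝓡

o : Game → Outcome
o G = outcome (lf G) (ls G)

mutual
  _+_ : Game → Game → Game
  ⟨ GL ∣ GR ⟩ + ⟨ HL ∣ HR ⟩ =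
    ⟨ addL GL ⟨ HL ∣ HR ⟩ ++ addR ⟨ GL ∣ GR ⟩ HL
    ∣ addL GR ⟨ HL ∣ HR ⟩ ++ addR ⟨ GL ∣ GR ⟩ HR ⟩

  addL : List Game → Game → List Game
  addL [] H = []
  addL (x ∷ xs) H = (x + H) ∷ addL xs H

  addR : Game → List Game → List Game
  addR G [] = []
  addR G (y ∷ ys) = (G + y) ∷ addR G ys

infixl 6 _+_

zeroG : Game
zeroG = ⟨ [] ∣ [] ⟩

int : ℕ → Game
int zero = zeroG
int (suc n) = ⟨ int n ∷ [] ∣ [] ⟩

intBar : ℕ → Game
intBar zero = zeroG
intBar (suc n) = ⟨ [] ∣ intBar n ∷ [] ⟩

IsLtp : Game → ℕ → Set
IsLtp G m = (o (G + intBar m) ≡ 𝓛) × (∀ k → k < m → o (G + intBar k) ≢ 𝓛)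

IsRtp : Game → ℕ → Set
IsRtp G m = (o (G + int m) ≡ 𝓡) × (∀ k → k < m → o (G + int k) ≢ 𝓡)

data Subpos : Game → Game → Set where
  here  : ∀ {G} → Subpos G G
  viaL  : ∀ {K G G'} → G' ∈ leftOpts G → Subpos K G' → Subpos K G
  viaR  : ∀ {K G G'} → G' ∈ rightOpts G → Subpos K G' → Subpos K G

StrictlyPFree : Game → Set
StrictlyPFree G = ∀ K → Subpos K G → o K ≢ 𝓟

LeftEnd : Game → Set
LeftEnd G = leftOpts G ≡ []

RightEnd : Game → Set
RightEnd G = rightOpts G ≡ []

mutual
  blockedLE : Game → Bool
  blockedLE ⟨ [] ∣ R ⟩ = allBL R
  blockedLE ⟨ _ ∷ _ ∣ _ ⟩ = false

  condBL : Game → Bool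
  condBL X@(⟨ L ∣ _ ⟩) = blockedLE X ∨ anyBL L

  allBL : List Game → Bool
  allBL [] = true
  allBL (x ∷ xs) = condBL x ∧ allBL xs

  anyBL : List Game → Bool
  anyBL [] = false
  anyBL (x ∷ xs) = blockedLE x ∨ anyBL xs

mutual
  blockedRE : Game → Bool
  blockedRE ⟨ L ∣ [] ⟩ = allBR L
  blockedRE ⟨ _ ∣ _ ∷ _ ⟩ = false

  condBR : Game → Bool
  condBR X@(⟨ _ ∣ R ⟩) = blockedRE X ∨ anyBR R

  allBR : List Game → Bool
  allBR [] = true
  allBR (x ∷ xs) = condBR x ∧ allBR xs

  anyBR : List Game → Bool
  anyBR [] = false
  anyBR (x ∷ xs) = blockedRE x ∨ anyBR xs

Blocking : Game → Set
Blocking G = ∀ K → Subpos K G →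
  (LeftEnd K → blockedLE K ≡ true) × (RightEnd K → blockedRE K ≡ true)

{-# OPTIONS --safe #-}
-- Everything reduces to two facts about Left moving first, proved by induction on positions.
-- (i) If X is a blocked Left end and Y is strictly 𝓟-free, Left wins X + Y moving first
-- whenever she wins Y moving first: she plays her strategy in Y, and a Right move in X
-- reaches either another blocked Left end or a position with a Left move to one, which
-- she takes. Strict 𝓟-freeness is what lets the induction continue after her move in Y:
-- an option she wins moving second is one she also wins moving first.
-- (ii) If H is a strictly 𝓟-free Right end that Left wins moving first, she wins Y + H
-- moving first for every Y whose Left-end subpositions are blocked: she follows her
-- strategy in Y until Y is a Left end and then applies (i).
-- A game is in 𝓝 iff Left wins moving first both in it and in its conjugate. Conjugation
-- distributes over + and swaps the roles of Left and Right ends, so with commutativity of +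
-- each case of the theorem is (i) for one of these two games and (ii) for the other.
module Submission where

open import Defs
open import Data.Bool using (true; false; _∧_; _∨_; not)
open import Data.Bool.Properties using (∨-comm; ∧-comm; ∨-assoc; ∧-assoc; not-involutive)
open import Data.List using (List; []; _∷_; _++_)
open import Data.List.Membership.Propositional using (_∈_)
open import Data.List.Membership.Propositional.Properties using (∈-++⁺ˡ; ∈-++⁺ʳ; ∈-++⁻)
open import Data.List.Relation.Unary.Any using (here; there)
open import Data.Product using (_×_; _,_; proj₁; proj₂; ∃-syntax)
open import Data.Sum using (_⊎_; inj₁; inj₂)
open import Function using (_∘_)
open import Induction.WellFounded using (WellFounded; Acc; acc)
open import Relation.Binary.PropositionalEquality
  using (_≡_; _≢_; refl; sym; trans; cong; cong₂; subst; module ≡-Reasoning)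
open import Relation.Nullary using (¬_; contradiction)

_≺_ : Game → Game → Set
x ≺ G = x ∈ leftOpts G ⊎ x ∈ rightOpts G

mutual
  ≺-wellFounded : WellFounded _≺_
  ≺-wellFounded ⟨ L ∣ R ⟩ = acc λ where
    (inj₁ x∈L) → ∈⇒Acc L x∈L
    (inj₂ x∈R) → ∈⇒Acc R x∈R

  ∈⇒Acc : ∀ {x} xs → x ∈ xs → Acc _≺_ x
  ∈⇒Acc (y ∷ _)  (here refl) = ≺-wellFounded y
  ∈⇒Acc (_ ∷ ys) (there x∈)  = ∈⇒Acc ys x∈

AllSubpos : (Game → Set) → Game → Set
AllSubpos P G = ∀ K → Subpos K G → P K

AllSubpos-≺ : ∀ {P x G} → x ≺ G → AllSubpos P G → AllSubpos P x
AllSubpos-≺ (inj₁ x∈) h K s = h K (viaL x∈ s)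
AllSubpos-≺ (inj₂ x∈) h K s = h K (viaR x∈ s)

LeftBlocking : Game → Set
LeftBlocking = AllSubpos λ K → LeftEnd K → blockedLE K ≡ true

Blocking⇒LeftBlocking : ∀ {G} → Blocking G → LeftBlocking G
Blocking⇒LeftBlocking b K s = proj₁ (b K s)

anyLs-intro : ∀ {x xs} → x ∈ xs → ls x ≡ true → anyLs xs ≡ true
anyLs-intro {xs = y ∷ ys} (here refl) lsx rewrite lsx = refl
anyLs-intro {xs = y ∷ ys} (there x∈) lsx with ls y
... | true  = refl
... | false = anyLs-intro x∈ lsx

anyLs-elim : ∀ xs → anyLs xs ≡ true → ∃[ x ] x ∈ xs × ls x ≡ true
anyLs-elim (y ∷ ys) any with ls y in lsy
... | true  = y , here refl , lsy
... | false with x , x∈ , lsx ← anyLs-elim ys any = x , there x∈ , lsx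

allLf-intro : ∀ xs → (∀ {x} → x ∈ xs → lf x ≡ true) → allLf xs ≡ true
allLf-intro []       all = refl
allLf-intro (y ∷ ys) all rewrite all (here refl) = allLf-intro ys (all ∘ there)

allLf-elim : ∀ {x xs} → allLf xs ≡ true → x ∈ xs → lf x ≡ true
allLf-elim {xs = y ∷ ys} all x∈ with lf y in lfy
allLf-elim {xs = y ∷ ys} all (here refl) | true = lfy
allLf-elim {xs = y ∷ ys} all (there x∈)  | true = allLf-elim all x∈

lf-leftEnd : ∀ G → LeftEnd G → lf G ≡ true
lf-leftEnd ⟨ [] ∣ _ ⟩ refl = refl

lf-intro : ∀ G {x} → x ∈ leftOpts G → ls x ≡ true → lf G ≡ true
lf-intro ⟨ _ ∷ _ ∣ _ ⟩ = anyLs-intro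

lf-elim : ∀ G → lf G ≡ true → LeftEnd G ⊎ ∃[ x ] x ∈ leftOpts G × ls x ≡ true
lf-elim ⟨ []     ∣ _ ⟩ _   = inj₁ refl
lf-elim ⟨ y ∷ ys ∣ _ ⟩ lfG = inj₂ (anyLs-elim (y ∷ ys) lfG)

ls-intro : ∀ G {x} → x ∈ rightOpts G →
  (∀ {z} → z ∈ rightOpts G → lf z ≡ true) → ls G ≡ true
ls-intro ⟨ _ ∣ y ∷ ys ⟩ _ = allLf-intro (y ∷ ys)

ls-elim : ∀ G → ls G ≡ true →
  (∃[ x ] x ∈ rightOpts G) × (∀ {z} → z ∈ rightOpts G → lf z ≡ true)
ls-elim ⟨ _ ∣ y ∷ _ ⟩ lsG = (y , here refl) , allLf-elim lsG

ls⇒lf : ∀ G → o G ≢ 𝓟 → ls G ≡ true → lf G ≡ true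
ls⇒lf G ¬𝓟 lsG with lf G
... | true  = refl
... | false rewrite lsG = contradiction refl ¬𝓟

∈-addL : ∀ {x xs} H → x ∈ xs → x + H ∈ addL xs H
∈-addL H (here refl) = here refl
∈-addL H (there x∈) = there (∈-addL H x∈)

∈-addR : ∀ {y ys} G → y ∈ ys → G + y ∈ addR G ys
∈-addR G (here refl) = here refl
∈-addR G (there y∈) = there (∈-addR G y∈)

∈-addL⁻ : ∀ {z} xs H → z ∈ addL xs H → ∃[ x ] x ∈ xs × z ≡ x + H
∈-addL⁻ (x ∷ _)  H (here refl) = x , here refl , refl
∈-addL⁻ (_ ∷ xs) H (there z∈) with x , x∈ , refl ← ∈-addL⁻ xs H z∈ =
  x , there x∈ , refl

∈-addR⁻ : ∀ {z} G ys → z ∈ addR G ys → ∃[ y ] y ∈ ys × z ≡ G + y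
∈-addR⁻ G (y ∷ _)  (here refl) = y , here refl , refl
∈-addR⁻ G (_ ∷ ys) (there z∈) with y , y∈ , refl ← ∈-addR⁻ G ys z∈ =
  y , there y∈ , refl

∈-leftOpts-+ˡ : ∀ {x} X Y → x ∈ leftOpts X → x + Y ∈ leftOpts (X + Y)
∈-leftOpts-+ˡ ⟨ _ ∣ _ ⟩ Y@(⟨ _ ∣ _ ⟩) x∈ = ∈-++⁺ˡ (∈-addL Y x∈)

∈-leftOpts-+ʳ : ∀ {y} X Y → y ∈ leftOpts Y → X + y ∈ leftOpts (X + Y)
∈-leftOpts-+ʳ X@(⟨ XL ∣ _ ⟩) Y@(⟨ _ ∣ _ ⟩) y∈ = ∈-++⁺ʳ (addL XL Y) (∈-addR X y∈)

∈-rightOpts-+ˡ : ∀ {x} X Y → x ∈ rightOpts X → x + Y ∈ rightOpts (X + Y)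
∈-rightOpts-+ˡ ⟨ _ ∣ _ ⟩ Y@(⟨ _ ∣ _ ⟩) x∈ = ∈-++⁺ˡ (∈-addL Y x∈)

∈-rightOpts-+ʳ : ∀ {y} X Y → y ∈ rightOpts Y → X + y ∈ rightOpts (X + Y)
∈-rightOpts-+ʳ X@(⟨ _ ∣ XR ⟩) Y@(⟨ _ ∣ _ ⟩) y∈ = ∈-++⁺ʳ (addL XR Y) (∈-addR X y∈)

∈-rightOpts-+⁻ : ∀ {z} X Y → z ∈ rightOpts (X + Y) →
  (∃[ x ] x ∈ rightOpts X × z ≡ x + Y) ⊎ (∃[ y ] y ∈ rightOpts Y × z ≡ X + y)
∈-rightOpts-+⁻ X@(⟨ _ ∣ XR ⟩) Y@(⟨ _ ∣ YR ⟩) z∈ with ∈-++⁻ (addL XR Y) z∈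
... | inj₁ z∈ˡ = inj₁ (∈-addL⁻ XR Y z∈ˡ)
... | inj₂ z∈ʳ = inj₂ (∈-addR⁻ X YR z∈ʳ)

LeftEnd-+ : ∀ X Y → LeftEnd X → LeftEnd Y → LeftEnd (X + Y)
LeftEnd-+ ⟨ [] ∣ _ ⟩ ⟨ [] ∣ _ ⟩ refl refl = refl

anyLs-++ : ∀ xs ys → anyLs (xs ++ ys) ≡ anyLs xs ∨ anyLs ys
anyLs-++ []       ys = refl
anyLs-++ (x ∷ xs) ys = trans (cong (ls x ∨_) (anyLs-++ xs ys)) (sym (∨-assoc (ls x) _ _))

allLf-++ : ∀ xs ys → allLf (xs ++ ys) ≡ allLf xs ∧ allLf ys
allLf-++ []       ys = refl
allLf-++ (x ∷ xs) ys = trans (cong (lf x ∧_) (allLf-++ xs ys)) (sym (∧-assoc (lf x) _ _))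

mutual
  lf-+-comm : ∀ X Y → lf (X + Y) ≡ lf (Y + X)
  lf-+-comm   ⟨ []    ∣ _ ⟩    ⟨ []    ∣ _ ⟩  = refl
  lf-+-comm X@(⟨ []    ∣ _ ⟩) Y@(⟨ _ ∷ _ ∣ _ ⟩) = anyLs-+-comm X Y
  lf-+-comm X@(⟨ _ ∷ _ ∣ _ ⟩) Y@(⟨ []    ∣ _ ⟩) = anyLs-+-comm X Y
  lf-+-comm X@(⟨ _ ∷ _ ∣ _ ⟩) Y@(⟨ _ ∷ _ ∣ _ ⟩) = anyLs-+-comm X Y

  ls-+-comm : ∀ X Y → ls (X + Y) ≡ ls (Y + X)
  ls-+-comm   ⟨ _ ∣ []    ⟩    ⟨ _ ∣ []    ⟩  = refl
  ls-+-comm X@(⟨ _ ∣ []    ⟩) Y@(⟨ _ ∣ _ ∷ _ ⟩) = allLf-+-comm X Y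
  ls-+-comm X@(⟨ _ ∣ _ ∷ _ ⟩) Y@(⟨ _ ∣ []    ⟩) = allLf-+-comm X Y
  ls-+-comm X@(⟨ _ ∣ _ ∷ _ ⟩) Y@(⟨ _ ∣ _ ∷ _ ⟩) = allLf-+-comm X Y

  anyLs-+-comm : ∀ X Y → anyLs (leftOpts (X + Y)) ≡ anyLs (leftOpts (Y + X))
  anyLs-+-comm X@(⟨ XL ∣ _ ⟩) Y@(⟨ YL ∣ _ ⟩) = begin
    anyLs (addL XL Y ++ addR X YL)         ≡⟨ anyLs-++ (addL XL Y) _ ⟩
    anyLs (addL XL Y) ∨ anyLs (addR X YL)  ≡⟨ cong₂ _∨_ (anyLs-addL XL Y) (sym (anyLs-addL YL X)) ⟩
    anyLs (addR Y XL) ∨ anyLs (addL YL X)  ≡⟨ ∨-comm (anyLs (addR Y XL)) _ ⟩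
    anyLs (addL YL X) ∨ anyLs (addR Y XL)  ≡⟨ anyLs-++ (addL YL X) _ ⟨
    anyLs (addL YL X ++ addR Y XL)         ∎
    where open ≡-Reasoning

  allLf-+-comm : ∀ X Y → allLf (rightOpts (X + Y)) ≡ allLf (rightOpts (Y + X))
  allLf-+-comm X@(⟨ _ ∣ XR ⟩) Y@(⟨ _ ∣ YR ⟩) = begin
    allLf (addL XR Y ++ addR X YR)         ≡⟨ allLf-++ (addL XR Y) _ ⟩
    allLf (addL XR Y) ∧ allLf (addR X YR)  ≡⟨ cong₂ _∧_ (allLf-addL XR Y) (sym (allLf-addL YR X)) ⟩
    allLf (addR Y XR) ∧ allLf (addL YR X)  ≡⟨ ∧-comm (allLf (addR Y XR)) _ ⟩
    allLf (addL YR X) ∧ allLf (addR Y XR)  ≡⟨ allLf-++ (addL YR X) _ ⟨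
    allLf (addL YR X ++ addR Y XR)         ∎
    where open ≡-Reasoning

  anyLs-addL : ∀ xs Y → anyLs (addL xs Y) ≡ anyLs (addR Y xs)
  anyLs-addL []       Y = refl
  anyLs-addL (x ∷ xs) Y = cong₂ _∨_ (ls-+-comm x Y) (anyLs-addL xs Y)

  allLf-addL : ∀ xs Y → allLf (addL xs Y) ≡ allLf (addR Y xs)
  allLf-addL []       Y = refl
  allLf-addL (x ∷ xs) Y = cong₂ _∧_ (lf-+-comm x Y) (allLf-addL xs Y)

mutual
  conj : Game → Game
  conj ⟨ L ∣ R ⟩ = ⟨ conjs R ∣ conjs L ⟩

  conjs : List Game → List Game
  conjs []       = []
  conjs (x ∷ xs) = conj x ∷ conjs xs

mutual
  lf-conj : ∀ G → lf (conj G) ≡ not (ls G)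
  lf-conj ⟨ _ ∣ [] ⟩     = refl
  lf-conj ⟨ _ ∣ x ∷ xs ⟩ = anyLs-conjs (x ∷ xs)

  ls-conj : ∀ G → ls (conj G) ≡ not (lf G)
  ls-conj ⟨ [] ∣ _ ⟩     = refl
  ls-conj ⟨ x ∷ xs ∣ _ ⟩ = allLf-conjs (x ∷ xs)

  anyLs-conjs : ∀ xs → anyLs (conjs xs) ≡ not (allLf xs)
  anyLs-conjs []       = refl
  anyLs-conjs (x ∷ xs) rewrite ls-conj x with lf x
  ... | true  = anyLs-conjs xs
  ... | false = refl

  allLf-conjs : ∀ xs → allLf (conjs xs) ≡ not (anyLs xs)
  allLf-conjs []       = refl
  allLf-conjs (x ∷ xs) rewrite lf-conj x with ls x
  ... | true  = refl
  ... | false = allLf-conjs xs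

conjOutcome : Outcome → Outcome
conjOutcome 𝓛 = 𝓡
conjOutcome 𝓝 = 𝓝
conjOutcome 𝓟 = 𝓟
conjOutcome 𝓡 = 𝓛

o-conj : ∀ G → o (conj G) ≡ conjOutcome (o G)
o-conj G rewrite lf-conj G | ls-conj G with lf G | ls G
... | true  | true  = refl
... | true  | false = refl
... | false | true  = refl
... | false | false = refl

conjs-++ : ∀ xs ys → conjs (xs ++ ys) ≡ conjs xs ++ conjs ys
conjs-++ []       ys = refl
conjs-++ (x ∷ xs) ys = cong (conj x ∷_) (conjs-++ xs ys)

mutual
  conj-+ : ∀ G H → conj (G + H) ≡ conj G + conj H
  conj-+ G@(⟨ GL ∣ GR ⟩) H@(⟨ HL ∣ HR ⟩) = cong₂ ⟨_∣_⟩
    (trans (conjs-++ (addL GR H) _) (cong₂ _++_ (conjs-addL GR H) (conjs-addR G HR)))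
    (trans (conjs-++ (addL GL H) _) (cong₂ _++_ (conjs-addL GL H) (conjs-addR G HL)))

  conjs-addL : ∀ xs H → conjs (addL xs H) ≡ addL (conjs xs) (conj H)
  conjs-addL []       H = refl
  conjs-addL (x ∷ xs) H = cong₂ _∷_ (conj-+ x H) (conjs-addL xs H)

  conjs-addR : ∀ G ys → conjs (addR G ys) ≡ addR (conj G) (conjs ys)
  conjs-addR G []       = refl
  conjs-addR G (y ∷ ys) = cong₂ _∷_ (conj-+ G y) (conjs-addR G ys)

mutual
  blockedLE-conj : ∀ X → blockedLE (conj X) ≡ blockedRE X
  blockedLE-conj ⟨ L ∣ [] ⟩    = allBL-conjs L
  blockedLE-conj ⟨ _ ∣ _ ∷ _ ⟩ = refl

  condBL-conj : ∀ X → condBL (conj X) ≡ condBR X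
  condBL-conj X@(⟨ _ ∣ R ⟩) = cong₂ _∨_ (blockedLE-conj X) (anyBL-conjs R)

  allBL-conjs : ∀ xs → allBL (conjs xs) ≡ allBR xs
  allBL-conjs []       = refl
  allBL-conjs (x ∷ xs) = cong₂ _∧_ (condBL-conj x) (allBL-conjs xs)

  anyBL-conjs : ∀ xs → anyBL (conjs xs) ≡ anyBR xs
  anyBL-conjs []       = refl
  anyBL-conjs (x ∷ xs) = cong₂ _∨_ (blockedLE-conj x) (anyBL-conjs xs)

LeftEnd-conj⇒RightEnd : ∀ G → LeftEnd (conj G) → RightEnd G
LeftEnd-conj⇒RightEnd ⟨ _ ∣ [] ⟩    _  = refl
LeftEnd-conj⇒RightEnd ⟨ _ ∣ _ ∷ _ ⟩ ()

LeftEnd⇒RightEnd-conj : ∀ G → LeftEnd G → RightEnd (conj G)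
LeftEnd⇒RightEnd-conj ⟨ [] ∣ _ ⟩ refl = refl

∈-conjs⁻ : ∀ {x} xs → x ∈ conjs xs → ∃[ x′ ] x′ ∈ xs × x ≡ conj x′
∈-conjs⁻ (x ∷ _)  (here refl) = x , here refl , refl
∈-conjs⁻ (_ ∷ xs) (there x∈) with x′ , x′∈ , refl ← ∈-conjs⁻ xs x∈ =
  x′ , there x′∈ , refl

Subpos-conj⁻ : ∀ {K} G → Subpos K (conj G) → ∃[ K′ ] K ≡ conj K′ × Subpos K′ G
Subpos-conj⁻ G here = G , refl , here
Subpos-conj⁻ ⟨ _ ∣ R ⟩ (viaL x∈ s) with ∈-conjs⁻ R x∈
... | x , x∈R , refl with Subpos-conj⁻ x s
...   | K′ , refl , s′ = K′ , refl , viaR x∈R s′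
Subpos-conj⁻ ⟨ L ∣ _ ⟩ (viaR x∈ s) with ∈-conjs⁻ L x∈
... | x , x∈L , refl with Subpos-conj⁻ x s
...   | K′ , refl , s′ = K′ , refl , viaL x∈L s′

AllSubpos-conj : ∀ {P Q : Game → Set} G → (∀ {K} → P K → Q (conj K)) →
  AllSubpos P G → AllSubpos Q (conj G)
AllSubpos-conj G P⇒Q h K s with K′ , refl , s′ ← Subpos-conj⁻ G s = P⇒Q (h K′ s′)

conjOutcome-≢𝓟 : ∀ {x} → x ≢ 𝓟 → conjOutcome x ≢ 𝓟
conjOutcome-≢𝓟 {𝓛} _   ()
conjOutcome-≢𝓟 {𝓝} _   ()
conjOutcome-≢𝓟 {𝓟} ¬𝓟 = ¬𝓟
conjOutcome-≢𝓟 {𝓡} _   ()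

StrictlyPFree-conj : ∀ G → StrictlyPFree G → StrictlyPFree (conj G)
StrictlyPFree-conj G = AllSubpos-conj G λ {K} ¬𝓟 →
  subst (_≢ 𝓟) (sym (o-conj K)) (conjOutcome-≢𝓟 ¬𝓟)

Blocking⇒LeftBlocking-conj : ∀ G → Blocking G → LeftBlocking (conj G)
Blocking⇒LeftBlocking-conj G = AllSubpos-conj G λ {K} bK leK̄ →
  trans (blockedLE-conj K) (proj₂ bK (LeftEnd-conj⇒RightEnd K leK̄))

outcome-𝓝 : ∀ a b → outcome a b ≡ 𝓝 → a ≡ true × b ≡ false
outcome-𝓝 true  true  ()
outcome-𝓝 true  false _ = refl , refl
outcome-𝓝 false true  ()
outcome-𝓝 false false ()

𝓝⇒lf : ∀ G → o G ≡ 𝓝 → lf G ≡ true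
𝓝⇒lf G = proj₁ ∘ outcome-𝓝 (lf G) (ls G)

𝓝⇒lf-conj : ∀ G → o G ≡ 𝓝 → lf (conj G) ≡ true
𝓝⇒lf-conj G oG = 𝓝⇒lf (conj G) (trans (o-conj G) (cong conjOutcome oG))

𝓝-intro : ∀ G → lf G ≡ true → lf (conj G) ≡ true → o G ≡ 𝓝
𝓝-intro G lfG lfḠ = cong₂ outcome lfG lsG
  where
  open ≡-Reasoning
  lsG : ls G ≡ false
  lsG = begin
    ls G               ≡⟨ not-involutive (ls G) ⟨
    not (not (ls G))   ≡⟨ cong not (lf-conj G) ⟨
    not (lf (conj G))  ≡⟨ cong not lfḠ ⟩
    false              ∎

lf-conj-+ : ∀ G H → lf (conj (G + H)) ≡ lf (conj H + conj G)
lf-conj-+ G H = trans (cong lf (conj-+ G H)) (lf-+-comm (conj G) (conj H))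

anyBL-elim : ∀ xs → anyBL xs ≡ true → ∃[ x ] x ∈ xs × blockedLE x ≡ true
anyBL-elim (y ∷ ys) any with blockedLE y in by
... | true  = y , here refl , by
... | false with x , x∈ , bx ← anyBL-elim ys any = x , there x∈ , bx

allBL-elim : ∀ {x xs} → allBL xs ≡ true → x ∈ xs → condBL x ≡ true
allBL-elim {xs = y ∷ ys} all x∈ with condBL y in cy
allBL-elim {xs = y ∷ ys} all (here refl) | true = cy
allBL-elim {xs = y ∷ ys} all (there x∈)  | true = allBL-elim all x∈

blockedLE⇒LeftEnd : ∀ X → blockedLE X ≡ true → LeftEnd X
blockedLE⇒LeftEnd ⟨ [] ∣ _ ⟩ _ = refl

blockedLE-rightOpt : ∀ X {x} → blockedLE X ≡ true → x ∈ rightOpts X →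
  blockedLE x ≡ true ⊎ ∃[ l ] l ∈ leftOpts x × blockedLE l ≡ true
blockedLE-rightOpt ⟨ [] ∣ _ ⟩ {x@(⟨ xL ∣ _ ⟩)} bX x∈ with blockedLE x | allBL-elim bX x∈
... | true  | _       = inj₁ refl
... | false | anyBLxL = inj₂ (anyBL-elim xL anyBLxL)

lf-blockedLeftEnd-+ : ∀ X Y → blockedLE X ≡ true → StrictlyPFree Y →
  lf Y ≡ true → lf (X + Y) ≡ true
lf-blockedLeftEnd-+ X Y = lf-+ (≺-wellFounded X) (≺-wellFounded Y)
  where
  mutual
    lf-+ : ∀ {X Y} → Acc _≺_ X → Acc _≺_ Y → blockedLE X ≡ true → StrictlyPFree Y →
      lf Y ≡ true → lf (X + Y) ≡ true
    lf-+ {X} {Y} accX (acc rsY) bX pY lfY with lf-elim Y lfY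
    ... | inj₁ leY = lf-leftEnd (X + Y) (LeftEnd-+ X Y (blockedLE⇒LeftEnd X bX) leY)
    ... | inj₂ (y , y∈ , lsy) =
      lf-intro (X + Y) (∈-leftOpts-+ʳ X Y y∈)
        (ls-+ accX (rsY (inj₁ y∈)) bX (AllSubpos-≺ (inj₁ y∈) pY)
          (ls⇒lf y (pY y (viaL y∈ here)) lsy) lsy)

    ls-+ : ∀ {X Y} → Acc _≺_ X → Acc _≺_ Y → blockedLE X ≡ true → StrictlyPFree Y →
      lf Y ≡ true → ls Y ≡ true → ls (X + Y) ≡ true
    ls-+ {X} {Y} accX@(acc rsX) accY@(acc rsY) bX pY lfY lsY =
      ls-intro (X + Y) (∈-rightOpts-+ʳ X Y (proj₂ y₀)) lf-rightOpt
      where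
      y₀ : ∃[ y ] y ∈ rightOpts Y
      y₀ = proj₁ (ls-elim Y lsY)

      lf-rightOpt : ∀ {z} → z ∈ rightOpts (X + Y) → lf z ≡ true
      lf-rightOpt z∈ with ∈-rightOpts-+⁻ X Y z∈
      ... | inj₂ (y , y∈ , refl) =
        lf-+ accX (rsY (inj₂ y∈)) bX (AllSubpos-≺ (inj₂ y∈) pY)
          (proj₂ (ls-elim Y lsY) y∈)
      ... | inj₁ (x , x∈ , refl) with blockedLE-rightOpt X bX x∈ | rsX (inj₂ x∈)
      ...   | inj₁ bx              | accx     = lf-+ accx accY bx pY lfY
      ...   | inj₂ (l , l∈ , bl)   | acc rsx  =
        lf-intro (x + Y) (∈-leftOpts-+ˡ x Y l∈)
          (ls-+ (rsx (inj₁ l∈)) accY bl pY lfY lsY)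

lf-+-rightEnd : ∀ Y H → RightEnd H → StrictlyPFree H → lf H ≡ true →
  LeftBlocking Y → lf Y ≡ true → lf (Y + H) ≡ true
lf-+-rightEnd Y H@(⟨ _ ∣ _ ⟩) refl pH lfH = lf-+ (≺-wellFounded Y)
  where
  mutual
    lf-+ : ∀ {Y} → Acc _≺_ Y → LeftBlocking Y → lf Y ≡ true → lf (Y + H) ≡ true
    lf-+ {Y} (acc rs) bY lfY with lf-elim Y lfY
    ... | inj₁ leY = lf-blockedLeftEnd-+ Y H (bY Y here leY) pH lfH
    ... | inj₂ (y , y∈ , lsy) =
      lf-intro (Y + H) (∈-leftOpts-+ˡ Y H y∈)
        (ls-+ (rs (inj₁ y∈)) (AllSubpos-≺ (inj₁ y∈) bY) lsy)

    ls-+ : ∀ {Y} → Acc _≺_ Y → LeftBlocking Y → ls Y ≡ true → ls (Y + H) ≡ true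
    ls-+ {Y} (acc rs) bY lsY = ls-intro (Y + H) (∈-rightOpts-+ˡ Y H (proj₂ y₀)) lf-rightOpt
      where
      y₀ : ∃[ y ] y ∈ rightOpts Y
      y₀ = proj₁ (ls-elim Y lsY)

      lf-rightOpt : ∀ {z} → z ∈ rightOpts (Y + H) → lf z ≡ true
      lf-rightOpt z∈ with ∈-rightOpts-+⁻ Y H z∈
      ... | inj₁ (y , y∈ , refl) =
        lf-+ (rs (inj₂ y∈)) (AllSubpos-≺ (inj₂ y∈) bY) (proj₂ (ls-elim Y lsY) y∈)
      ... | inj₂ (_ , () , _)

𝓝-+-leftEnd : ∀ G H → Blocking G → Blocking H → StrictlyPFree G → StrictlyPFree H →
  o G ≡ 𝓝 → o H ≡ 𝓝 → LeftEnd G → o (G + H) ≡ 𝓝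
𝓝-+-leftEnd G H bG bH pG pH oG oH leG = 𝓝-intro (G + H)
  (lf-blockedLeftEnd-+ G H (proj₁ (bG G here) leG) pH (𝓝⇒lf H oH))
  (trans (lf-conj-+ G H)
    (lf-+-rightEnd (conj H) (conj G) (LeftEnd⇒RightEnd-conj G leG) (StrictlyPFree-conj G pG)
      (𝓝⇒lf-conj G oG) (Blocking⇒LeftBlocking-conj H bH) (𝓝⇒lf-conj H oH)))

𝓝-+-rightEnd : ∀ G H → Blocking G → Blocking H → StrictlyPFree G → StrictlyPFree H →
  o G ≡ 𝓝 → o H ≡ 𝓝 → RightEnd H → o (G + H) ≡ 𝓝
𝓝-+-rightEnd G H bG bH pG pH oG oH reH = 𝓝-intro (G + H)
  (lf-+-rightEnd G H reH pH (𝓝⇒lf H oH) (Blocking⇒LeftBlocking bG) (𝓝⇒lf G oG))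
  (trans (lf-conj-+ G H)
    (lf-blockedLeftEnd-+ (conj H) (conj G) (trans (blockedLE-conj H) (proj₂ (bH H here) reH))
      (StrictlyPFree-conj G pG) (𝓝⇒lf-conj G oG)))

lemma4p8 : ∀ (G H : Game) → Blocking G → Blocking H →
    StrictlyPFree G → StrictlyPFree H → o G ≡ 𝓝 → o H ≡ 𝓝 →
    (IsRtp G 1 → IsLtp H 1 → LeftEnd G → ¬ LeftEnd H → o (G + H) ≡ 𝓝)
    × (IsLtp G 1 → IsRtp H 1 → RightEnd H → ¬ RightEnd G → o (G + H) ≡ 𝓝)
lemma4p8 G H bG bH pG pH oG oH =
    (λ _ _ leG _ → 𝓝-+-leftEnd G H bG bH pG pH oG oH leG)
  , (λ _ _ reH _ → 𝓝-+-rightEnd G H bG bH pG pH oG oH reH)
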